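{- Let $t\ge 2$, $A=\{0,1,\ldots,t-1\}$, let $s>1$ and $n\ge s$ be integers, and let $P$ be a preference function of span $s-1$ whose induced least preference function $g$ satisfies $g(0^{s-1})=0^{s-1}$ and has no cycles other than this self-loop (for every $x\in A^{s-1}\setminus\{0^{s-1}\}$ there is no $k\ge1$ with $g^k(x)=x$). Let $S$ be the sequence produced by Algorithm P with inputs $s,n,P$. If $X_1=(x_1,\ldots,x_n)\in A^n$ does not occur in $S$ as a block of contiguous symbols, then neither does $X_2=(x_2,\ldots,x_n,c)$, where $c=P_t(x_{n-s+2},\ldots,x_n)$.
   Context: A preference function $P$ of span $s-1$ assigns to each $\mathbf a\in A^{s-1}$ a vector $(P_1(\mathbf a),\ldots,P_t(\mathbf a))$ whose entries form a permutation of $A$. Its least preference function is $g(a_1,\ldots,a_{s-1})=(a_2,\ldots,a_{s-1},P_t(a_1,\ldots,a_{s-1}))$. $0^m$ denotes the word of $m$ zeros. Algorithm P produces a finite sequence $(a_i)$: $a_1=\cdots=a_n=0$; if $a_{N+1},\ldots,a_{N+n-1}$ have been defined (starting with $N=1$), set $a_{N+n}=P_i(a_{N+n-s+1},\ldots,a_{N+n-1})$ where $i\in\{1,\ldots,t\}$ is the smallest index such that the word $(a_{N+1},\ldots,a_{N+n-1},P_i(a_{N+n-s+1},\ldots,a_{N+n-1}))$ has not previously appeared as a block of contiguous symbols of the sequence; if no such $i$ exists, the sequence ends at $a_{N+n-1}$. -}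

module Defs where

open import Data.Nat using (ℕ; zero; suc; _∸_; _^_; _≤_; z≤n; s≤s; NonZero)
open import Data.Fin using (Fin; fromℕ)
open import Data.Fin.Permutation using (Permutation′; _⟨$⟩ʳ_)
open import Data.Fin.Properties using (_≟_)
open import Data.List as List using (List; []; _∷_; _++_; [_]; length; drop; filter; allFin; reverse)
open import Data.Vec as Vec using (Vec; []; _∷_; _∷ʳ_; toList)
open import Data.Maybe using (Maybe; just; nothing)
open import Data.Product using (_,_)
open import Relation.Binary.PropositionalEquality using (_≡_)
open import Relation.Nullary using (¬_)
open import Relation.Nullary.Decidable using (¬?)
open import Data.List.Relation.Binary.Infix.Heterogeneous using (Infix)
open import Data.List.Relation.Binary.Infix.Heterogeneous.Properties using (infix?)

-- A preference function of span m: to every word a ∈ A^m it assigns a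
-- permutation of A; P_i(a) (i = 1,…,t) is the image of the index i-1.
PrefFun : ℕ → ℕ → Set
PrefFun t m = Vec (Fin t) m → Permutation′ t

lastFin : (t : ℕ) → .{{NonZero t}} → Fin t
lastFin (suc k) = fromℕ k

Pt : ∀ {t m} → .{{NonZero t}} → PrefFun t m → Vec (Fin t) m → Fin t
Pt {t} P a = P a ⟨$⟩ʳ lastFin t

leastPref : ∀ {t m} → .{{NonZero t}} → PrefFun t m → Vec (Fin t) m → Vec (Fin t) m
leastPref P a = Vec.tail (a ∷ʳ Pt P a)

iter : ∀ {X : Set} → (X → X) → ℕ → X → X
iter f zero x = x
iter f (suc k) x = f (iter f k x)

zeros : ∀ {t} → .{{NonZero t}} → (m : ℕ) → Vec (Fin t) m
zeros {suc _} m = Vec.replicate m Fin.zero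
  where import Data.Fin as Fin

OccursIn : ∀ {t} → List (Fin t) → List (Fin t) → Set
OccursIn w xs = Infix _≡_ w xs

takeLE : ∀ {X : Set} {k n} → k ≤ n → Vec X n → Vec X k
takeLE z≤n _ = []
takeLE (s≤s p) (x ∷ xs) = x ∷ takeLE p xs

lastLE : ∀ {X : Set} {k n} → k ≤ n → Vec X n → Vec X k
lastLE p xs = Vec.reverse (takeLE p (Vec.reverse xs))

takeVec : ∀ {X : Set} (k : ℕ) → List X → Maybe (Vec X k)
takeVec zero _ = just []
takeVec (suc k) [] = nothing
takeVec (suc k) (x ∷ xs) with takeVec k xs
... | just v = just (x ∷ v)
... | nothing = nothing

lastVec : ∀ {X : Set} (k : ℕ) → List X → Maybe (Vec X k)
lastVec k xs with takeVec k (reverse xs)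
... | just v = just (Vec.reverse v)
... | nothing = nothing

firstJust : ∀ {X : Set} → List X → Maybe X
firstJust [] = nothing
firstJust (x ∷ _) = just x

module AlgorithmP {t : ℕ} (s n : ℕ) (P : PrefFun t (s ∸ 1)) where

  -- the next symbol a_{N+n} given the sequence a_1 … a_{N+n-1} built so far,
  -- or nothing if the sequence ends here
  next : List (Fin t) → Maybe (Fin t)
  next xs with lastVec (s ∸ 1) xs
  ... | nothing = nothing   -- unreachable: the sequence always has length ≥ n ≥ s-1
  ... | just ctx = Data.Maybe.map (λ i → P ctx ⟨$⟩ʳ i) (firstJust (filter fresh? (allFin t)))
    where
      import Data.Maybe
      window : List (Fin t)
      window = drop (length xs ∸ (n ∸ 1)) xs
      fresh? = λ (i : Fin t) → ¬? (infix? _≟_ (window ++ [ P ctx ⟨$⟩ʳ i ]) xs)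

  run : ℕ → List (Fin t) → List (Fin t)
  run zero xs = xs
  run (suc f) xs with next xs
  ... | nothing = xs
  ... | just c = run f (xs ++ [ c ])

-- The sequence S produced by Algorithm P with inputs s, n, P.
-- Each step appends a new n-word, so there are fewer than t^n steps and the
-- fuel t^n is never exhausted: the algorithm stops by itself.
algorithmP : ∀ {t} → .{{NonZero t}} → (s n : ℕ) → PrefFun t (s ∸ 1) → List (Fin t)
algorithmP {t} s n P = AlgorithmP.run s n P (t ^ n) (toList (zeros n))

module Submission where

-- The proof uses only the mechanics of Algorithm P.  Write m = n-1 and r = s-1.  We show that
-- the final sequence S satisfies an invariant, maintained by every step:
--   (I1) S begins with 0^n;  (I2) every n-word occurs at most once in S;
--   (I3) if w c occurs in S at a position other than the first, where |w| = m and
--        c is the least preferred symbol after the last r symbols of w, then every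
--        extension w b occurs in S (P_t is chosen only when all else was used).
-- By (I2) the run stops before its fuel t^n is exhausted, so moreover (I4) every
-- extension of the final m-window of S occurs in S.
-- The core is a counting argument: if for every b the m-word w is preceded by some
-- symbol p_b at an occurrence followed by φ(b), with φ injective, then b ↦ p_b is
-- injective by (I2), hence onto, so every x₁ precedes w somewhere.  Applying it to
-- the occurrences of w b supplied by (I3) (w ≠ 0^m), or by (I4) together with the
-- end of S (w = 0^m, the final window being 0^m), shows that x₁ w occurs in S.

open import Defs
open import Data.Nat using (ℕ; _∸_; _<_; _≤_; NonZero)
open import Data.Nat.Properties using (≤-trans; m∸n≤m)
open import Data.Fin using (Fin)
open import Data.Vec using (Vec; toList; tail; _∷ʳ_)
open import Relation.Binary.PropositionalEquality using (_≡_; _≢_)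
open import Relation.Nullary using (¬_)

open import Data.Nat using (zero; suc; _+_; _^_; z≤n; s≤s; s≤s⁻¹)
import Data.Nat.Properties as ℕ
import Data.Fin as F
import Data.Fin.Properties as FP
open import Data.Fin.Permutation using (_⟨$⟩ʳ_; _⟨$⟩ˡ_; inverseˡ; inverseʳ)
open import Data.List
  using (List; []; _∷_; _++_; [_]; length; take; drop; filter; reverse; replicate; allFin; head; initLast; _∷ʳ′_)
import Data.List.Properties as LP
open import Data.List.Membership.Propositional using (_∈_)
open import Data.List.Membership.Propositional.Properties using (∈-filter⁺; ∈-filter⁻; ∈-allFin)
open import Data.List.Relation.Unary.Any using (here; there)
import Data.List.Relation.Unary.All as All
open import Data.List.Relation.Unary.AllPairs using (AllPairs; _∷_)
import Data.List.Relation.Unary.AllPairs.Properties as AllPairs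
open import Data.List.Relation.Binary.Infix.Heterogeneous using (Infix; MkView; toView; fromView; _ⁱ++_)
open import Data.List.Relation.Binary.Infix.Heterogeneous.Properties using (infix?)
open import Data.List.Relation.Binary.Pointwise using (Pointwise-≡⇒≡; ≡⇒Pointwise-≡)
import Data.Vec as V
import Data.Vec.Properties as VP
open import Data.Maybe using (Maybe; just; nothing)
import Data.Maybe as Maybe
open import Data.Product using (∃; ∃₂; _×_; _,_; proj₁; proj₂)
open import Data.Sum using (_⊎_; inj₁; inj₂)
open import Data.Empty using (⊥-elim)
open import Function using (id)
open import Function.Definitions using (Injective)
open import Relation.Binary.PropositionalEquality using (refl; sym; trans; cong; cong₂; subst; subst₂; module ≡-Reasoning)
open import Relation.Nullary using (yes; no)
open import Relation.Nullary.Decidable using (¬?; decidable-stable)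
open import Relation.Unary using (Decidable)

module _ {A : Set} where

  infix⇒split : ∀ {u S : List A} → Infix _≡_ u S → ∃₂ λ as bs → S ≡ as ++ u ++ bs
  infix⇒split occ with toView occ
  ... | MkView as u≋ bs with Pointwise-≡⇒≡ u≋
  ... | refl = as , bs , refl

  split⇒infix : ∀ {u S : List A} as bs → S ≡ as ++ u ++ bs → Infix _≡_ u S
  split⇒infix as bs refl = fromView (MkView as (≡⇒Pointwise-≡ refl) bs)

  EndsWith : List A → List A → Set
  EndsWith w v = ∃ λ front → w ≡ front ++ v

  suffix⇒infix : ∀ {S u : List A} → EndsWith S u → Infix _≡_ u S
  suffix⇒infix {u = u} (f , eq) = split⇒infix f [] (trans eq (cong (f ++_) (sym (LP.++-identityʳ u))))

  length-snoc : ∀ (xs : List A) x → length (xs ++ [ x ]) ≡ suc (length xs)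
  length-snoc xs x = trans (LP.length-++ xs) (ℕ.+-comm (length xs) 1)

  ++-cancel-length : ∀ as cs {xs ys : List A} → as ++ xs ≡ cs ++ ys → length as ≡ length cs → as ≡ cs × xs ≡ ys
  ++-cancel-length []       []       eq _   = refl , eq
  ++-cancel-length (a ∷ as) (c ∷ cs) eq len =
    let a≡c , eq′ = LP.∷-injective eq
        as≡cs , xs≡ys = ++-cancel-length as cs eq′ (ℕ.suc-injective len)
    in cong₂ _∷_ a≡c as≡cs , xs≡ys

  front-length : ∀ as cs {xs ys : List A} → as ++ xs ≡ cs ++ ys → length xs ≡ length ys → length as ≡ length cs
  front-length as cs {xs} {ys} eq len = ℕ.+-cancelʳ-≡ (length xs) (length as) (length cs) (begin
      length as + length xs  ≡⟨ LP.length-++ as ⟨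
      length (as ++ xs)      ≡⟨ cong length eq ⟩
      length (cs ++ ys)      ≡⟨ LP.length-++ cs ⟩
      length cs + length ys  ≡⟨ cong (length cs +_) len ⟨
      length cs + length xs  ∎)
    where open ≡-Reasoning

  EndsWith-unique : ∀ {w u v : List A} → EndsWith w u → EndsWith w v → length u ≡ length v → u ≡ v
  EndsWith-unique (fu , refl) (fv , eq) len = proj₂ (++-cancel-length fu fv eq (front-length fu fv eq len))

  EndsWith-tail : ∀ {x} {w v : List A} → EndsWith (x ∷ w) v → length v ≤ length w → EndsWith w v
  EndsWith-tail {w = w} ([] , refl) short = ⊥-elim (ℕ.1+n≰n short)
  EndsWith-tail (y ∷ f , eq) _ = f , LP.∷-injectiveʳ eq

  occurs-at-start : ∀ as (u bs : List A) → length (as ++ u ++ bs) ≤ length u → as ≡ []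
  occurs-at-start []       u bs _     = refl
  occurs-at-start (a ∷ as) u bs long =
    ⊥-elim (ℕ.1+n≰n (ℕ.≤-trans long (ℕ.≤-trans (LP.length-++-≤ˡ u) (LP.length-++-≤ʳ (u ++ bs) {as}))))

  replicate-snoc : ∀ j (x : A) → replicate (suc j) x ≡ replicate j x ++ [ x ]
  replicate-snoc zero    x = refl
  replicate-snoc (suc j) x = cong (x ∷_) (replicate-snoc j x)

  -- u occurs in S, followed there by the symbol y (y = nothing: u ends S).
  OccursFollowedBy : List A → List A → Maybe A → Set
  OccursFollowedBy S u y = ∃₂ λ as bs → S ≡ as ++ u ++ bs × head bs ≡ y

  occurs : ∀ {S u y} → OccursFollowedBy S u y → Infix _≡_ u S
  occurs (as , bs , eq , _) = split⇒infix as bs eq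

  proper-suffix-preceded : ∀ {S W : List A} → EndsWith S W → length W < length S →
                           ∃ λ pe → OccursFollowedBy S (pe ∷ W) nothing
  proper-suffix-preceded {S} {W} (f , eq) shorter with initLast f
  ... | [] = ⊥-elim (ℕ.<-irrefl (cong length (sym eq)) shorter)
  ... | pre ∷ʳ′ pe = pe , pre , [] , trans eq reassoc , refl
    where
    open ≡-Reasoning
    reassoc : (pre ++ [ pe ]) ++ W ≡ pre ++ (pe ∷ W) ++ []
    reassoc = begin
      (pre ++ [ pe ]) ++ W   ≡⟨ LP.++-assoc pre [ pe ] W ⟩
      pre ++ pe ∷ W          ≡⟨ cong (λ z → pre ++ pe ∷ z) (LP.++-identityʳ W) ⟨
      pre ++ (pe ∷ W) ++ []  ∎

  UniqueWindows : ℕ → List A → Set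
  UniqueWindows n S = ∀ as bs cs ds (u : List A) → length u ≡ n →
                      S ≡ as ++ u ++ bs → S ≡ cs ++ u ++ ds → length as ≡ length cs

  follower-unique : ∀ {n S u y y′} → UniqueWindows n S → length u ≡ n →
                    OccursFollowedBy S u y → OccursFollowedBy S u y′ → y ≡ y′
  follower-unique {u = u} uniq len (as , bs , e₁ , refl) (cs , ds , e₂ , refl) =
    cong head (LP.++-cancelˡ u bs ds (proj₂ (++-cancel-length as cs (trans (sym e₁) e₂) (uniq as bs cs ds u len e₁ e₂))))

  block-at : ∀ n j (S : List A) → j + n ≤ length S →
             S ≡ take j S ++ take n (drop j S) ++ drop n (drop j S) ×
             length (take j S) ≡ j × length (take n (drop j S)) ≡ n
  block-at n j S fits =
      sym (trans (cong (take j S ++_) (LP.take++drop≡id n (drop j S))) (LP.take++drop≡id j S))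
    , trans (LP.length-take j S) (ℕ.m≤n⇒m⊓n≡m (ℕ.m+n≤o⇒m≤o j fits))
    , trans (LP.length-take n (drop j S)) (ℕ.m≤n⇒m⊓n≡m rest-long)
    where
    rest-long : n ≤ length (drop j S)
    rest-long = subst (n ≤_) (sym (LP.length-drop j S))
                  (subst (_≤ length S ∸ j) (ℕ.m+n∸m≡n j n) (ℕ.∸-monoˡ-≤ j fits))

injective⇒onto : ∀ {t} (f : Fin t → Fin t) → Injective _≡_ _≡_ f → ∀ x → ∃ λ b → f b ≡ x
injective⇒onto {suc k} f inj x with FP.any? (λ b → f b FP.≟ x)
... | yes hit = hit
... | no miss = ⊥-elim (ℕ.1+n≰n (FP.injective⇒≤ punched-injective))
  where
  punched : Fin (suc k) → Fin k
  punched b = F.punchOut {i = x} {j = f b} (λ x≡fb → miss (b , sym x≡fb))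
  punched-injective : Injective _≡_ _≡_ punched
  punched-injective {a} {b} eq = inj (FP.punchOut-injective (λ x≡fa → miss (a , sym x≡fa)) (λ x≡fb → miss (b , sym x≡fb)) eq)

every-symbol-precedes : ∀ {t m} {S w : List (Fin t)} → UniqueWindows (suc m) S → length w ≡ m →
  (φ : Fin t → Maybe (Fin t)) → Injective _≡_ _≡_ φ →
  (∀ b → ∃ λ p → OccursFollowedBy S (p ∷ w) (φ b)) →
  ∀ x → ∃ λ b → OccursFollowedBy S (x ∷ w) (φ b)
every-symbol-precedes {S = S} {w} uniq lw φ φ-injective occ x =
  let b , pb≡x = injective⇒onto predecessor predecessor-injective x
  in b , subst (λ p → OccursFollowedBy S (p ∷ w) (φ b)) pb≡x (proj₂ (occ b))
  where
  predecessor : Fin _ → Fin _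
  predecessor b = proj₁ (occ b)
  predecessor-injective : Injective _≡_ _≡_ predecessor
  predecessor-injective {a} {b} eq = φ-injective (follower-unique uniq (cong suc lw)
    (subst (λ p → OccursFollowedBy S (p ∷ w) (φ a)) eq (proj₂ (occ a))) (proj₂ (occ b)))

numeral : ∀ {k} j → List (Fin (suc k)) → Fin (suc k ^ j)
numeral     zero    _        = F.zero
numeral {k} (suc j) []       = F.combine {suc k} F.zero (numeral j [])
numeral {k} (suc j) (x ∷ xs) = F.combine {suc k} x (numeral j xs)

numeral-injective : ∀ {k} j (xs ys : List (Fin (suc k))) → length xs ≡ j → length ys ≡ j →
                    numeral j xs ≡ numeral j ys → xs ≡ ys
numeral-injective zero    []       []       _  _  _  = refl
numeral-injective {k} (suc j) (x ∷ xs) (y ∷ ys) lx ly eq =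
  cong₂ _∷_ (FP.combine-injectiveˡ {suc k} {suc k ^ j} x _ y _ eq)
    (numeral-injective j xs ys (ℕ.suc-injective lx) (ℕ.suc-injective ly)
      (FP.combine-injectiveʳ {suc k} {suc k ^ j} x _ y _ eq))

-- A list with unique n-windows has fewer than n + t^n symbols, since its first
-- 1 + t^n windows would be distinct words among only t^n.
unique-windows-bound : ∀ {k n} (S : List (Fin (suc k))) → UniqueWindows n S → ¬ (n + suc k ^ n ≤ length S)
unique-windows-bound {k} {n} S uniq long = ℕ.1+n≰n (FP.injective⇒≤ code-injective)
  where
  fits : ∀ (i : Fin (suc (suc k ^ n))) → F.toℕ i + n ≤ length S
  fits i = ℕ.≤-trans (ℕ.+-monoˡ-≤ n (s≤s⁻¹ (FP.toℕ<n i))) (subst (_≤ length S) (ℕ.+-comm n _) long)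
  block before after : Fin (suc (suc k ^ n)) → List (Fin (suc k))
  block  i = take n (drop (F.toℕ i) S)
  before i = take (F.toℕ i) S
  after  i = drop n (drop (F.toℕ i) S)
  code : Fin (suc (suc k ^ n)) → Fin (suc k ^ n)
  code i = numeral n (block i)
  code-injective : Injective _≡_ _≡_ code
  code-injective {i} {j} eq = FP.toℕ-injective (begin
      F.toℕ i             ≡⟨ proj₁ (proj₂ split-i) ⟨
      length (before i)   ≡⟨ uniq (before i) (after i) (before j) (after j) (block j) (proj₂ (proj₂ split-j))
                                  (subst (λ u → S ≡ before i ++ u ++ after i) same-block (proj₁ split-i)) (proj₁ split-j) ⟩
      length (before j)   ≡⟨ proj₁ (proj₂ split-j) ⟩
      F.toℕ j             ∎)
    where
    open ≡-Reasoning
    split-i = block-at n (F.toℕ i) S (fits i)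
    split-j = block-at n (F.toℕ j) S (fits j)
    same-block : block i ≡ block j
    same-block = numeral-injective n (block i) (block j) (proj₂ (proj₂ split-i)) (proj₂ (proj₂ split-j)) eq

takeVec-prefix : ∀ {X : Set} j (l : List X) → j ≤ length l → ∃ λ v → takeVec j l ≡ just v × l ≡ toList v ++ drop j l
takeVec-prefix zero    l       _        = V.[] , refl , refl
takeVec-prefix (suc j) (x ∷ l) (s≤s j≤) with takeVec j l | takeVec-prefix j l j≤
... | just v  | .v , refl , eq = x V.∷ v , refl , cong (x ∷_) eq
... | nothing | _ , () , _

takeLE-prefix : ∀ {X : Set} {i j} (p : i ≤ j) (u : Vec X j) → ∃ λ rest → toList u ≡ toList (takeLE p u) ++ rest
takeLE-prefix z≤n     u         = toList u , refl
takeLE-prefix (s≤s p) (x V.∷ u) = let rest , eq = takeLE-prefix p u in rest , cong (x ∷_) eq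

reverse-prefix⇒suffix : ∀ {X : Set} {j} (l : List X) (v : Vec X j) rest →
                        reverse l ≡ toList v ++ rest → EndsWith l (toList (V.reverse v))
reverse-prefix⇒suffix l v rest eq = reverse rest , (begin
    l                                      ≡⟨ LP.reverse-involutive l ⟨
    reverse (reverse l)                    ≡⟨ cong reverse eq ⟩
    reverse (toList v ++ rest)             ≡⟨ LP.reverse-++ (toList v) rest ⟩
    reverse rest ++ reverse (toList v)     ≡⟨ cong (reverse rest ++_) (VP.toList-reverse v) ⟨
    reverse rest ++ toList (V.reverse v)   ∎)
  where open ≡-Reasoning

lastVec-suffix : ∀ {X : Set} j (l : List X) → j ≤ length l → ∃ λ v → lastVec j l ≡ just v × EndsWith l (toList v)
lastVec-suffix j l j≤ with takeVec j (reverse l) | takeVec-prefix j (reverse l) (subst (j ≤_) (sym (LP.length-reverse l)) j≤)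
... | just v  | .v , refl , eq = V.reverse v , refl , reverse-prefix⇒suffix l v _ eq
... | nothing | _ , () , _

lastLE-suffix : ∀ {X : Set} {i j} (p : i ≤ j) (v : Vec X j) → EndsWith (toList v) (toList (lastLE p v))
lastLE-suffix p v =
  let rest , eq = takeLE-prefix p (V.reverse v)
  in reverse-prefix⇒suffix (toList v) (takeLE p (V.reverse v)) rest (trans (sym (VP.toList-reverse v)) eq)

module _ {t : ℕ} {Q : Fin t → Set} (Q? : Decidable Q) where

  filtered-increasing : AllPairs F._<_ (filter Q? (allFin t))
  filtered-increasing = AllPairs.filter⁺ Q? (AllPairs.tabulate⁺-< {f = id} id)

  search-fails : firstJust (filter Q? (allFin t)) ≡ nothing → ∀ i → ¬ Q i
  search-fails failed i qi with filter Q? (allFin t) | ∈-filter⁺ Q? (∈-allFin i) qi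
  search-fails () i qi | _ ∷ _ | _

  search-finds-least : ∀ {i} → firstJust (filter Q? (allFin t)) ≡ just i → Q i × (∀ j → Q j → i F.≤ j)
  search-finds-least found with filter Q? (allFin t) in eq | filtered-increasing
  search-finds-least refl | i ∷ rest | i<rest ∷ _ = Q-i , least
    where
    Q-i : Q i
    Q-i = proj₂ (∈-filter⁻ Q? {xs = allFin t} (subst (i ∈_) (sym eq) (here refl)))
    least : ∀ j → Q j → i F.≤ j
    least j qj with subst (j ∈_) eq (∈-filter⁺ Q? (∈-allFin j) qj)
    ... | here refl     = FP.≤-refl
    ... | there j∈rest = ℕ.<⇒≤ (All.lookup i<rest j∈rest)

map-nothing : ∀ {X Y : Set} {f : X → Y} (mx : Maybe X) → Maybe.map f mx ≡ nothing → mx ≡ nothing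
map-nothing nothing _ = refl

map-just : ∀ {X Y : Set} {f : X → Y} (mx : Maybe X) {y} → Maybe.map f mx ≡ just y → ∃ λ x → mx ≡ just x × f x ≡ y
map-just (just x) refl = x , refl , refl

-- Algorithm P with t = k+1, span r = s-1 ≤ m = n-1 and preference function P.
module Analysis (k r m : ℕ) (r≤m : r ≤ m) (P : PrefFun (suc k) r) where

  t n : ℕ
  t = suc k
  n = suc m

  A : Set
  A = Fin t

  open AlgorithmP {t} (suc r) n P using (next; run)

  zeroWord : ℕ → List A
  zeroWord j = replicate j F.zero

  extension-nonzero : ∀ {w} b → w ≢ zeroWord m → w ++ [ b ] ≢ zeroWord n
  extension-nonzero {w} b w≢0 eq = w≢0 (LP.∷ʳ-injectiveˡ w (zeroWord m) (trans eq (replicate-snoc m F.zero)))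

  window front : List A → List A
  window xs = drop (length xs ∸ m) xs
  front  xs = take (length xs ∸ m) xs

  window-split : ∀ (xs : List A) → m ≤ length xs → xs ≡ front xs ++ window xs × length (window xs) ≡ m
  window-split xs m≤ = sym (LP.take++drop≡id (length xs ∸ m) xs)
                     , trans (LP.length-drop (length xs ∸ m) xs) (ℕ.m∸[m∸n]≡n m≤)

  fresh? : (xs : List A) (ctx : Vec A r) → Decidable (λ i → ¬ Infix _≡_ (window xs ++ [ P ctx ⟨$⟩ʳ i ]) xs)
  fresh? xs ctx i = ¬? (infix? FP._≟_ (window xs ++ [ P ctx ⟨$⟩ʳ i ]) xs)

  next-unfold : ∀ (xs : List A) {ctx} → lastVec r xs ≡ just ctx →
                next xs ≡ Maybe.map (P ctx ⟨$⟩ʳ_) (firstJust (filter (fresh? xs ctx) (allFin t)))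
  next-unfold xs {ctx} found with lastVec r xs | found
  ... | just .ctx | refl = refl

  context : ∀ (xs : List A) → m ≤ length xs → ∃ λ ctx → lastVec r xs ≡ just ctx × EndsWith xs (toList ctx)
  context xs m≤ = lastVec-suffix r xs (ℕ.≤-trans r≤m m≤)

  next-stops : ∀ (xs : List A) → m ≤ length xs → next xs ≡ nothing → ∀ b → Infix _≡_ (window xs ++ [ b ]) xs
  next-stops xs m≤ stopped b with context xs m≤
  ... | ctx , found , _ = subst (λ z → Infix _≡_ (window xs ++ [ z ]) xs) (inverseʳ (P ctx))
        (decidable-stable (infix? FP._≟_ _ xs) (search-fails (fresh? xs ctx) search-failed (P ctx ⟨$⟩ˡ b)))
    where
    search-failed : firstJust (filter (fresh? xs ctx) (allFin t)) ≡ nothing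
    search-failed = map-nothing {f = λ i → P ctx ⟨$⟩ʳ i} _ (trans (sym (next-unfold xs {ctx} found)) stopped)

  next-appends : ∀ (xs : List A) c → m ≤ length xs → next xs ≡ just c →
    ¬ Infix _≡_ (window xs ++ [ c ]) xs ×
    (∀ (v : Vec A r) → EndsWith xs (toList v) → c ≡ Pt P v → ∀ b → b ≢ c → Infix _≡_ (window xs ++ [ b ]) xs)
  next-appends xs c m≤ appended with context xs m≤
  ... | ctx , found , ends with map-just _ (trans (sym (next-unfold xs {ctx} found)) appended)
  ... | i , search , i↦c = subst (λ z → ¬ Infix _≡_ (window xs ++ [ z ]) xs) i↦c (proj₁ chosen) , others-old
    where
    chosen : ¬ Infix _≡_ (window xs ++ [ P ctx ⟨$⟩ʳ i ]) xs ×
             (∀ j → ¬ Infix _≡_ (window xs ++ [ P ctx ⟨$⟩ʳ j ]) xs → i F.≤ j)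
    chosen = search-finds-least (fresh? xs ctx) search
    others-old : ∀ (v : Vec A r) → EndsWith xs (toList v) → c ≡ Pt P v →
                 ∀ b → b ≢ c → Infix _≡_ (window xs ++ [ b ]) xs
    others-old v ends-v least b b≢c =
      subst (λ z → Infix _≡_ (window xs ++ [ z ]) xs) (inverseʳ (P ctx))
        (decidable-stable (infix? FP._≟_ _ xs) j-old)
      where
      open ≡-Reasoning
      ctx≡v : ctx ≡ v
      ctx≡v = trans (sym (VP.cast-is-id refl ctx)) (VP.toList-injective refl ctx v
                (EndsWith-unique ends ends-v (trans (VP.length-toList ctx) (sym (VP.length-toList v)))))
      c-last : c ≡ P ctx ⟨$⟩ʳ F.fromℕ k
      c-last = subst (λ u → c ≡ Pt P u) (sym ctx≡v) least
      i-last : i ≡ F.fromℕ k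
      i-last = begin
        i                                  ≡⟨ inverseˡ (P ctx) ⟨
        P ctx ⟨$⟩ˡ (P ctx ⟨$⟩ʳ i)          ≡⟨ cong (P ctx ⟨$⟩ˡ_) (trans i↦c c-last) ⟩
        P ctx ⟨$⟩ˡ (P ctx ⟨$⟩ʳ F.fromℕ k)  ≡⟨ inverseˡ (P ctx) ⟩
        F.fromℕ k                          ∎
      j = P ctx ⟨$⟩ˡ b
      j-old : ¬ ¬ Infix _≡_ (window xs ++ [ P ctx ⟨$⟩ʳ j ]) xs
      j-old fresh-j = b≢c (begin
        b                       ≡⟨ inverseʳ (P ctx) ⟨
        P ctx ⟨$⟩ʳ j            ≡⟨ cong (P ctx ⟨$⟩ʳ_) j-last ⟩
        P ctx ⟨$⟩ʳ F.fromℕ k    ≡⟨ c-last ⟨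
        c                       ∎)
        where
        j-last : j ≡ F.fromℕ k
        j-last = FP.≤-antisym (FP.≤fromℕ j) (subst (F._≤ j) i-last (proj₂ chosen j fresh-j))

  append-occurrence : ∀ (xs : List A) c as bs u → m ≤ length xs → length u ≡ n → xs ++ [ c ] ≡ as ++ u ++ bs →
    (∃ λ bs′ → xs ≡ as ++ u ++ bs′) ⊎ (u ≡ window xs ++ [ c ] × length as ≡ length (front xs))
  append-occurrence xs c as bs u m≤ len eq with initLast bs
  ... | bs′ ∷ʳ′ y = inj₁ (bs′ , LP.∷ʳ-injectiveˡ xs (as ++ u ++ bs′) (trans eq reassoc))
    where
    open ≡-Reasoning
    reassoc : as ++ u ++ bs′ ++ [ y ] ≡ (as ++ u ++ bs′) ++ [ y ]
    reassoc = begin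
      as ++ u ++ bs′ ++ [ y ]      ≡⟨ cong (as ++_) (LP.++-assoc u bs′ [ y ]) ⟨
      as ++ (u ++ bs′) ++ [ y ]    ≡⟨ LP.++-assoc as (u ++ bs′) [ y ] ⟨
      (as ++ u ++ bs′) ++ [ y ]    ∎
  ... | [] with initLast u
  ...   | [] = ⊥-elim (ℕ.0≢1+n len)
  ...   | u′ ∷ʳ′ y = inj₂ (cong₂ (λ a b → a ++ [ b ]) u′≡window (sym c≡y) , front-length as (front xs) xs-split u′-length)
    where
    eq′ : xs ++ [ c ] ≡ (as ++ u′) ++ [ y ]
    eq′ = trans eq (trans (cong (as ++_) (LP.++-identityʳ (u′ ++ [ y ]))) (sym (LP.++-assoc as u′ [ y ])))
    xs≡ : xs ≡ as ++ u′
    xs≡ = LP.∷ʳ-injectiveˡ xs (as ++ u′) eq′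
    c≡y : c ≡ y
    c≡y = LP.∷ʳ-injectiveʳ xs (as ++ u′) eq′
    split : xs ≡ front xs ++ window xs × length (window xs) ≡ m
    split = window-split xs m≤
    xs-split : as ++ u′ ≡ front xs ++ window xs
    xs-split = trans (sym xs≡) (proj₁ split)
    u′-length : length u′ ≡ length (window xs)
    u′-length = trans (ℕ.suc-injective (trans (sym (length-snoc u′ y)) len)) (sym (proj₂ split))
    u′≡window : u′ ≡ window xs
    u′≡window = EndsWith-unique (as , sym xs-split) (front xs , refl) u′-length

  ForcedExtensions : List A → Set
  ForcedExtensions S = ∀ as bs w (v : Vec A r) → as ≢ [] → length w ≡ m → EndsWith w (toList v) →
                       S ≡ as ++ (w ++ [ Pt P v ]) ++ bs → ∀ b → Infix _≡_ (w ++ [ b ]) S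

  record Invariant (S : List A) : Set where
    field
      long         : n ≤ length S
      zeros-prefix : ∃ λ rest → S ≡ zeroWord n ++ rest
      unique       : UniqueWindows n S
      forced       : ForcedExtensions S

  initial : List A
  initial = toList (zeros {t} n)

  initial-length : length initial ≡ n
  initial-length = VP.length-toList (zeros {t} n)

  initial-invariant : Invariant initial
  initial-invariant = record
    { long         = ℕ.≤-reflexive (sym initial-length)
    ; zeros-prefix = [] , trans (VP.toList-replicate n F.zero) (sym (LP.++-identityʳ (zeroWord n)))
    ; unique       = λ as bs cs ds u len e₁ e₂ → cong length (trans (at-start as bs u len e₁) (sym (at-start cs ds u len e₂)))
    ; forced       = λ as bs w v as≢[] lw _ e _ → ⊥-elim (as≢[] (at-start as bs _ (trans (length-snoc w _) (cong suc lw)) e))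
    }
    where
    at-start : ∀ as bs u → length u ≡ n → initial ≡ as ++ u ++ bs → as ≡ []
    at-start as bs u len eq = occurs-at-start as u bs
      (ℕ.≤-reflexive (trans (cong length (sym eq)) (trans initial-length (sym len))))

  step : ∀ (xs : List A) c → Invariant xs → next xs ≡ just c → Invariant (xs ++ [ c ])
  step xs c inv appended = record
    { long         = subst (n ≤_) (sym (length-snoc xs c)) (ℕ.m≤n⇒m≤1+n long)
    ; zeros-prefix = let rest , eq = zeros-prefix in
                     rest ++ [ c ] , trans (cong (_++ [ c ]) eq) (LP.++-assoc (zeroWord n) rest [ c ])
    ; unique       = unique′
    ; forced       = forced′
    }
    where
    open Invariant inv
    m≤ : m ≤ length xs
    m≤ = ℕ.≤-trans (ℕ.n≤1+n m) long
    split : xs ≡ front xs ++ window xs × length (window xs) ≡ m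
    split = window-split xs m≤
    new = next-appends xs c m≤ appended
    window-c-ends : EndsWith (xs ++ [ c ]) (window xs ++ [ c ])
    window-c-ends = front xs , trans (cong (_++ [ c ]) (proj₁ split)) (LP.++-assoc (front xs) (window xs) [ c ])

    unique′ : UniqueWindows n (xs ++ [ c ])
    unique′ as bs cs ds u len e₁ e₂ with append-occurrence xs c as bs u m≤ len e₁
                                       | append-occurrence xs c cs ds u m≤ len e₂
    ... | inj₁ (bs′ , o₁) | inj₁ (ds′ , o₂) = unique as bs′ cs ds′ u len o₁ o₂
    ... | inj₁ (bs′ , o₁) | inj₂ (refl , _) = ⊥-elim (proj₁ new (split⇒infix as bs′ o₁))
    ... | inj₂ (refl , _) | inj₁ (ds′ , o₂) = ⊥-elim (proj₁ new (split⇒infix cs ds′ o₂))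
    ... | inj₂ (_ , l₁)   | inj₂ (_ , l₂)   = trans l₁ (sym l₂)

    forced′ : ForcedExtensions (xs ++ [ c ])
    forced′ as bs w v as≢[] lw ends e b
      with append-occurrence xs c as bs (w ++ [ Pt P v ]) m≤ (trans (length-snoc w _) (cong suc lw)) e
    ... | inj₁ (bs′ , o) = forced as bs′ w v as≢[] lw ends o b ⁱ++ [ c ]
    ... | inj₂ (last , _) with LP.∷ʳ-injective w (window xs) last
    ...   | refl , Pt≡c with b FP.≟ c
    ...     | yes refl = suffix⇒infix window-c-ends
    ...     | no b≢c = proj₂ new v xs-ends (sym Pt≡c) b b≢c ⁱ++ [ c ]
      where
      xs-ends : EndsWith xs (toList v)
      xs-ends = let f , eq = ends in
                front xs ++ f , trans (proj₁ split) (trans (cong (front xs ++_) eq) (sym (LP.++-assoc (front xs) f _)))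

  run-halts : ∀ fuel xs → Invariant xs → n + t ^ n ≤ length xs + fuel →
              Invariant (run fuel xs) × next (run fuel xs) ≡ nothing
  run-halts zero xs inv enough =
    ⊥-elim (unique-windows-bound xs (Invariant.unique inv) (subst (n + t ^ n ≤_) (ℕ.+-identityʳ _) enough))
  run-halts (suc fuel) xs inv enough with next xs in nxt
  ... | nothing = inv , nxt
  ... | just c  = run-halts fuel (xs ++ [ c ]) (step xs c inv nxt)
                    (subst (n + t ^ n ≤_) (trans (ℕ.+-suc (length xs) fuel) (cong (_+ fuel) (sym (length-snoc xs c)))) enough)

  module Stopped (S : List A) (inv : Invariant S) (stopped : next S ≡ nothing) where

    open Invariant inv

    m<S : m < length S
    m<S = long

    S-split : S ≡ front S ++ window S × length (window S) ≡ m
    S-split = window-split S (ℕ.<⇒≤ m<S)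

    non-initial : ∀ {u} → Infix _≡_ u S → length u ≡ n → u ≢ zeroWord n → ∃₂ λ as bs → as ≢ [] × S ≡ as ++ u ++ bs
    non-initial {u} occ len u≢0 with infix⇒split occ
    ... | a ∷ as , bs , e = a ∷ as , bs , (λ ()) , e
    ... | [] , bs , e = ⊥-elim (u≢0 (proj₁ (++-cancel-length u (zeroWord n) (trans (sym e) (proj₂ zeros-prefix))
                                            (trans len (sym (LP.length-replicate n))))))

    has-predecessor : ∀ {w b} → length w ≡ m → w ++ [ b ] ≢ zeroWord n → Infix _≡_ (w ++ [ b ]) S →
                      ∃ λ p → OccursFollowedBy S (p ∷ w) (just b)
    has-predecessor {w} {b} lw not-zero occ with non-initial occ (trans (length-snoc w b) (cong suc lw)) not-zero
    ... | as , bs , as≢[] , e with initLast as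
    ...   | [] = ⊥-elim (as≢[] refl)
    ...   | as′ ∷ʳ′ p = p , as′ , b ∷ bs , trans e reassoc , refl
      where
      open ≡-Reasoning
      reassoc : (as′ ++ [ p ]) ++ (w ++ [ b ]) ++ bs ≡ as′ ++ (p ∷ w) ++ b ∷ bs
      reassoc = begin
        (as′ ++ [ p ]) ++ (w ++ [ b ]) ++ bs  ≡⟨ LP.++-assoc as′ [ p ] _ ⟩
        as′ ++ p ∷ (w ++ [ b ]) ++ bs         ≡⟨ cong (λ z → as′ ++ p ∷ z) (LP.++-assoc w [ b ] bs) ⟩
        as′ ++ (p ∷ w) ++ b ∷ bs              ∎

    extensions⇒predecessors : ∀ {w} → length w ≡ m → w ≢ zeroWord m → (∀ b → Infix _≡_ (w ++ [ b ]) S) →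
                              ∀ x → ∃ λ b → OccursFollowedBy S (x ∷ w) (just b)
    extensions⇒predecessors lw w≢0 all-occur =
      every-symbol-precedes unique lw just (λ { refl → refl })
        (λ b → has-predecessor lw (extension-nonzero b w≢0) (all-occur b))

    final-extensions : ∀ b → Infix _≡_ (window S ++ [ b ]) S
    final-extensions = next-stops S (ℕ.<⇒≤ m<S) stopped

    end-preceded : ∃ λ pe → OccursFollowedBy S (pe ∷ window S) nothing
    end-preceded = proper-suffix-preceded (front S , proj₁ S-split) (subst (_< length S) (sym (proj₂ S-split)) m<S)

    -- The final window is 0^m: otherwise its predecessor at the end of S would also
    -- precede one of its extensions, which all occur by (I4).
    final-window-zero : window S ≡ zeroWord m
    final-window-zero = decidable-stable (LP.≡-dec FP._≟_ (window S) (zeroWord m)) not-nonzero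
      where
      not-nonzero : ¬ ¬ window S ≡ zeroWord m
      not-nonzero w≢0 =
        let pe , at-end   = end-preceded
            b  , followed = extensions⇒predecessors (proj₂ S-split) w≢0 final-extensions pe
        in just≢nothing (follower-unique unique (cong suc (proj₂ S-split)) followed at-end)
        where
        just≢nothing : ∀ {b : A} → just b ≢ nothing
        just≢nothing ()

    -- Every symbol precedes 0^m in S: the extensions 0^m b with b ≠ 0 occur by (I4)
    -- and are preceded by symbols, and the final window 0^m is preceded by one more.
    zeros-preceded : ∀ x → Infix _≡_ (x ∷ zeroWord m) S
    zeros-preceded x = occurs (proj₂ (every-symbol-precedes unique (LP.length-replicate m) follower follower-injective predecessor x))
      where
      follower : A → Maybe A
      follower F.zero    = nothing
      follower (F.suc j) = just (F.suc j)
      follower-injective : Injective _≡_ _≡_ follower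
      follower-injective {F.zero}  {F.zero}  _    = refl
      follower-injective {F.suc _} {F.suc _} refl = refl
      follower-injective {F.zero}  {F.suc _} ()
      follower-injective {F.suc _} {F.zero}  ()
      predecessor : ∀ b → ∃ λ p → OccursFollowedBy S (p ∷ zeroWord m) (follower b)
      predecessor F.zero    = subst (λ w → ∃ λ p → OccursFollowedBy S (p ∷ w) nothing) final-window-zero end-preceded
      predecessor (F.suc j) = has-predecessor (LP.length-replicate m) last-nonzero
        (subst (λ w → Infix _≡_ (w ++ [ F.suc j ]) S) final-window-zero (final-extensions (F.suc j)))
        where
        last-nonzero : zeroWord m ++ [ F.suc j ] ≢ zeroWord n
        last-nonzero eq = FP.0≢1+n (sym (LP.∷ʳ-injectiveʳ (zeroWord m) (zeroWord m) (trans eq (replicate-snoc m F.zero))))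

    shifted-absent : ∀ x (w : List A) (v : Vec A r) → length w ≡ m → EndsWith w (toList v) →
                     ¬ Infix _≡_ (x ∷ w) S → ¬ Infix _≡_ (w ++ [ Pt P v ]) S
    shifted-absent x w v lw ends absent occ with LP.≡-dec FP._≟_ w (zeroWord m)
    ... | yes refl = absent (zeros-preceded x)
    ... | no w≢0 with non-initial occ (trans (length-snoc w _) (cong suc lw)) (extension-nonzero _ w≢0)
    ...   | as , bs , as≢[] , e =
            absent (occurs (proj₂ (extensions⇒predecessors lw w≢0 (forced as bs w v as≢[] lw ends e) x)))

  S : List A
  S = algorithmP (suc r) n P

  S-final : Invariant S × next S ≡ nothing
  S-final = run-halts (t ^ n) initial initial-invariant
              (subst (λ l → n + t ^ n ≤ l + t ^ n) (sym initial-length) ℕ.≤-refl)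

mainTheorem6 : (t : ℕ) → .{{_ : NonZero t}} → 2 ≤ t → (s n : ℕ) → 1 < s → (s≤n : s ≤ n)
    → (P : PrefFun t (s ∸ 1))
    → leastPref P (zeros (s ∸ 1)) ≡ zeros (s ∸ 1)
    → (∀ (x : Vec (Fin t) (s ∸ 1)) → x ≢ zeros (s ∸ 1) → ∀ (k : ℕ) → 1 ≤ k → iter (leastPref P) k x ≢ x)
    → (X : Vec (Fin t) n)
    → ¬ OccursIn (toList X) (algorithmP s n P)
    → ¬ OccursIn (toList (tail (X ∷ʳ Pt P (lastLE (≤-trans (m∸n≤m s 1) s≤n) X)))) (algorithmP s n P)
mainTheorem6 (suc k) _ (suc r) (suc m) _ (s≤s r≤m) P _ _ (x V.∷ w) absent shifted =
  Stopped.shifted-absent S (proj₁ S-final) (proj₂ S-final) x (toList w) v (VP.length-toList w) w-ends-with-v absent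
    (subst (λ u → Infix _≡_ u S) (VP.toList-∷ʳ (Pt P v) w) shifted)
  where
  open Analysis k r m r≤m P
  r≤n : r ≤ suc m
  r≤n = ≤-trans (m∸n≤m (suc r) 1) (s≤s r≤m)
  v : Vec (Fin (suc k)) r
  v = lastLE r≤n (x V.∷ w)
  w-ends-with-v : EndsWith (toList w) (toList v)
  w-ends-with-v = EndsWith-tail (lastLE-suffix r≤n (x V.∷ w))
    (subst₂ _≤_ (sym (VP.length-toList v)) (sym (VP.length-toList w)) r≤m)
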